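{- There exists a periodic graph $\mathcal{G}$ with footprint $G$ such that $c(G)<c(\mathcal{G})<c(G_{\max})$.
   Context: All graphs are finite, undirected and reflexive. A periodic graph with period $p\ge1$ is a sequence $\mathcal{G}=(G_0,\dots,G_{p-1})$ of graphs $G_i=(V,E_i)$ on a common vertex set, extended by $G_{i+p}=G_i$; its footprint is $G=(V,\bigcup_iE_i)$, assumed connected. Cops and Robber on a periodic graph with $k$ cops (perfect information): cops choose starting vertices, then the robber; in each round $t=0,1,\dots$ each cop moves to a vertex of $N_{G_{t\bmod p}}[\text{its position}]$, then the robber likewise; the cops win if a cop ever moves onto the robber's vertex. The cop number $c(\cdot)$ is the least $k$ such that $k$ cops have a winning strategy; a static graph is a periodic graph of period $1$. $c(G_{\max})=\max_{0\le i\le p-1}c(G_i)$. -}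

module Defs where

open import Data.Nat using (ℕ; zero; suc; _<_; _⊔_)
open import Data.Nat.DivMod using (_mod_)
open import Data.Fin using (Fin)
import Data.Fin as F
open import Data.Product using (Σ; ∃; _×_; _,_)
open import Data.Sum using (_⊎_)
open import Data.Unit using (⊤)
open import Relation.Binary.PropositionalEquality using (_≡_)
open import Relation.Nullary using (¬_)

record PeriodicGraph : Set₁ where
  field
    n     : ℕ
    q     : ℕ
    E     : Fin (suc q) → Fin n → Fin n → Set
    E-refl : ∀ i v → E i v v
    E-sym  : ∀ i u v → E i u v → E i v u

  period : ℕ
  period = suc q

open PeriodicGraph public

record Graph : Set₁ where
  field
    vn     : ℕ
    Adj    : Fin vn → Fin vn → Set
    Adj-refl : ∀ v → Adj v v
    Adj-sym  : ∀ u v → Adj u v → Adj v u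

open Graph public

static : Graph → PeriodicGraph
static G = record
  { n = vn G ; q = 0 ; E = λ _ → Adj G
  ; E-refl = λ _ → Adj-refl G ; E-sym = λ _ → Adj-sym G }

layer : (𝒢 : PeriodicGraph) → Fin (period 𝒢) → Graph
layer 𝒢 i = record
  { vn = n 𝒢 ; Adj = E 𝒢 i ; Adj-refl = E-refl 𝒢 i ; Adj-sym = E-sym 𝒢 i }

footprint : PeriodicGraph → Graph
footprint 𝒢 = record
  { vn = n 𝒢
  ; Adj = λ u v → ∃ λ i → E 𝒢 i u v
  ; Adj-refl = λ v → Fin.zero , E-refl 𝒢 Fin.zero v
  ; Adj-sym = λ u v → λ { (i , e) → i , E-sym 𝒢 i u v e } }

data Reach (G : Graph) (u : Fin (vn G)) : Fin (vn G) → Set where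
  here : Reach G u u
  step : ∀ {v w} → Reach G u v → Adj G v w → Reach G u w

Connected : Graph → Set
Connected G = Σ (Fin (vn G)) (λ _ → ⊤) × (∀ u v → Reach G u v)

-- Win 𝒢 k t cs r : it is round t, the cops are at cs, the robber at r, and
-- the cops are to move; the cops can force a capture (a cop moving onto the
-- robber's vertex) in finitely many rounds, whatever the robber does.
data Win (𝒢 : PeriodicGraph) (k : ℕ) (t : ℕ)
         (cs : Fin k → Fin (n 𝒢)) (r : Fin (n 𝒢)) : Set where
  move : (cs' : Fin k → Fin (n 𝒢))
       → (∀ j → E 𝒢 (t mod period 𝒢) (cs j) (cs' j))
       → ((∃ λ j → cs' j ≡ r)
          ⊎ (∀ r' → E 𝒢 (t mod period 𝒢) r r' → Win 𝒢 k (suc t) cs' r'))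
       → Win 𝒢 k t cs r

CopsWin : PeriodicGraph → ℕ → Set
CopsWin 𝒢 k = ∃ λ (cs : Fin k → Fin (n 𝒢)) → ∀ r → Win 𝒢 k 0 cs r

IsCopNumber : PeriodicGraph → ℕ → Set
IsCopNumber 𝒢 c = CopsWin 𝒢 c × (∀ k → k < c → ¬ CopsWin 𝒢 k)

maxFin : ∀ {m} → (Fin m → ℕ) → ℕ
maxFin {zero} f = 0
maxFin {suc m} f = f Fin.zero ⊔ maxFin (λ i → f (Fin.suc i))

-- Take three layers on five vertices whose restrictions to {0,1,2,3} are the
-- three perfect matchings of K₄, with vertex 4 isolated in layer 0 and joined to
-- 1 in layers 1 and 2. The footprint is K₄ with a pendant vertex at 1, so one cop
-- at 1 wins. Every component of a layer is dominated by one of its vertices, so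
-- the cop number of a layer is its number of components: 3, 2, 2. In the periodic
-- game cops at 0 and 1 win within two rounds, but a single cop loses: the robber
-- stays on {0,1,2,3} outside the cop's closed neighbourhood in the current layer.
-- His pair {r, r'} of the current matching is split by the next matching, in which
-- the closed neighbourhood of any vertex meets {0,1,2,3} in at most one pair, so
-- r or r' is out of the cop's reach in the next round.

module Submission where

open import Defs
open import Data.Bool using (Bool; true; false; T)
open import Data.Fin using (Fin; zero; suc; toℕ; #_)
open import Data.Fin.Properties
  using (_≟_; all?; any?; ¬∀⟶∃¬; injective⇒≤; toℕ-injective; toℕ-fromℕ<)
open import Data.Nat using (ℕ; suc; _+_; _<_; _%_; NonZero; s≤s)
open import Data.Nat.DivMod using (_mod_; %-distribˡ-+; m%n%n≡m%n)
open import Data.Nat.Properties using (<⇒≱; n<1+n)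
open import Data.Product using (Σ; ∃; _×_; _,_; proj₁; proj₂)
open import Data.Sum using (_⊎_; inj₁; inj₂; [_,_])
open import Data.Unit using (tt)
open import Data.Vec using ([]; _∷_; lookup)
open import Data.Vec.Functional using (updateAt)
open import Data.Vec.Functional.Properties using (updateAt-updates; updateAt-minimal)
open import Function using (const)
open import Level using (0ℓ)
open import Relation.Binary using (Rel; Decidable)
open import Relation.Binary.Construct.Closure.Reflexive using (ReflClosure)
import Relation.Binary.Construct.Closure.Reflexive as Refl
import Relation.Binary.Construct.Closure.Reflexive.Properties as Refl
open import Relation.Binary.Construct.Closure.Symmetric using (SymClosure; fwd; bwd; symmetric)
open import Relation.Binary.PropositionalEquality
  using (_≡_; _≢_; refl; sym; trans; cong; subst; module ≡-Reasoning)
open import Relation.Nullary using (¬_; Dec; yes; no)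
open import Relation.Nullary.Decidable using (T?; ¬?; _×-dec_; _⊎-dec_; _→-dec_; map′; from-yes)

missed-value : ∀ {k m} → k < m → (f : Fin k → Fin m) → ∃ λ ℓ → ∀ j → f j ≢ ℓ
missed-value {k} {m} k<m f with ¬∀⟶∃¬ m _ (λ ℓ → any? λ j → f j ≟ ℓ) not-onto
  where
  not-onto : ¬ (∀ ℓ → ∃ λ j → f j ≡ ℓ)
  not-onto onto = <⇒≱ k<m (injective⇒≤ section-injective)
    where
    section-injective : ∀ {ℓ ℓ′} → proj₁ (onto ℓ) ≡ proj₁ (onto ℓ′) → ℓ ≡ ℓ′
    section-injective {ℓ} {ℓ′} eq =
      trans (sym (proj₂ (onto ℓ))) (trans (cong f eq) (proj₂ (onto ℓ′)))
... | ℓ , missed = ℓ , λ j fj≡ℓ → missed (j , fj≡ℓ)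

suc-mod : ∀ t p .{{_ : NonZero p}} → suc t mod p ≡ suc (toℕ (t mod p)) mod p
suc-mod t p = toℕ-injective (begin
  toℕ (suc t mod p)                 ≡⟨ toℕ-fromℕ< _ ⟩
  suc t % p                         ≡⟨ %-distribˡ-+ 1 t p ⟩
  (1 % p + t % p) % p               ≡⟨ cong (λ x → (1 % p + x) % p) (sym (m%n%n≡m%n t p)) ⟩
  (1 % p + t % p % p) % p           ≡⟨ sym (%-distribˡ-+ 1 (t % p) p) ⟩
  suc (t % p) % p                   ≡⟨ cong (λ x → suc x % p) (sym (toℕ-fromℕ< _)) ⟩
  suc (toℕ (t mod p)) % p           ≡⟨ sym (toℕ-fromℕ< _) ⟩
  toℕ (suc (toℕ (t mod p)) mod p)   ∎)
  where open ≡-Reasoning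

symClosure? : ∀ {A : Set} {R : Rel A 0ℓ} → Decidable R → Decidable (SymClosure R)
symClosure? R? a b = map′ [ fwd , bwd ] (λ { (fwd r) → inj₁ r ; (bwd r) → inj₂ r }) (R? a b ⊎-dec R? b a)

module _ (𝒢 : PeriodicGraph) {k : ℕ} where

  Vertex : Set
  Vertex = Fin (n 𝒢)

  Edge[_] : ℕ → Rel Vertex 0ℓ
  Edge[ t ] = E 𝒢 (t mod period 𝒢)

  CopMove : ℕ → (Fin k → Vertex) → (Fin k → Vertex) → Set
  CopMove t cs cs′ = ∀ j → Edge[ t ] (cs j) (cs′ j)

  stay : ∀ t cs → CopMove t cs cs
  stay t cs j = E-refl 𝒢 _ (cs j)

  capture : ∀ {t cs r} j → Edge[ t ] (cs j) r → Win 𝒢 k t cs r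
  capture {t} {cs} {r} j e = move cs′ moves (inj₁ (j , updateAt-updates j cs))
    where
    cs′ : Fin k → Vertex
    cs′ = updateAt cs j (const r)
    moves : CopMove t cs cs′
    moves j′ with j′ ≟ j
    ... | yes refl = subst (Edge[ t ] (cs j)) (sym (updateAt-updates j cs)) e
    ... | no j′≢j  = subst (Edge[ t ] (cs j′)) (sym (updateAt-minimal j′ j cs j′≢j)) (stay t cs j′)

  wait : ∀ {t cs r} → (∀ r′ → Edge[ t ] r r′ → Win 𝒢 k (suc t) cs r′) → Win 𝒢 k t cs r
  wait {t} {cs} next = move cs (stay t cs) (inj₂ next)

  dominating⇒CopsWin : (cs : Fin k → Vertex) → (∀ r → ∃ λ j → Edge[ 0 ] (cs j) r) → CopsWin 𝒢 k
  dominating⇒CopsWin cs dom = cs , λ r → capture (proj₁ (dom r)) (proj₂ (dom r))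

  Escape : (ℕ → (Fin k → Vertex) → Vertex → Set) → Set
  Escape Safe = ∀ t cs r → Safe t cs r → ∀ cs′ → CopMove t cs cs′ →
    (∀ j → cs′ j ≢ r) × ∃ λ r′ → Edge[ t ] r r′ × Safe (suc t) cs′ r′

  module _ {Safe : ℕ → (Fin k → Vertex) → Vertex → Set} (escape : Escape Safe) where

    escape⇒¬Win : ∀ {t cs r} → Safe t cs r → ¬ Win 𝒢 k t cs r
    escape⇒¬Win safe (move cs′ moves outcome) with escape _ _ _ safe cs′ moves | outcome
    ... | uncaught , _ , _ , _     | inj₁ (j , caught) = uncaught j caught
    ... | _ , r′ , e , safe′       | inj₂ continue    = escape⇒¬Win safe′ (continue r′ e)

    escape⇒¬CopsWin : (∀ cs → ∃ λ r → Safe 0 cs r) → ¬ CopsWin 𝒢 k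
    escape⇒¬CopsWin start (cs , win) with start cs
    ... | r , safe = escape⇒¬Win safe (win r)

module _ (𝒢 : PeriodicGraph) {m : ℕ}
         (class : Fin (n 𝒢) → Fin m) (member : Fin m → Fin (n 𝒢))
         (class-respects : ∀ i u v → E 𝒢 i u v → class u ≡ class v)
         (class-member : ∀ ℓ → class (member ℓ) ≡ ℓ) where

  fewer-cops-than-classes⇒¬CopsWin : ∀ k → k < m → ¬ CopsWin 𝒢 k
  fewer-cops-than-classes⇒¬CopsWin k k<m = escape⇒¬CopsWin 𝒢 {k} {Safe} escape start
    where
    Safe : ℕ → (Fin k → Fin (n 𝒢)) → Fin (n 𝒢) → Set
    Safe _ cs r = ∀ j → class (cs j) ≢ class r
    escape : Escape 𝒢 Safe
    escape t cs r safe cs′ moves = uncaught , r , E-refl 𝒢 (t mod period 𝒢) r , safe′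
      where
      safe′ : Safe (suc t) cs′ r
      safe′ j eq = safe j (trans (class-respects _ _ _ (moves j)) eq)
      uncaught : ∀ j → cs′ j ≢ r
      uncaught j refl = safe′ j refl
    start : ∀ cs → ∃ λ r → Safe 0 cs r
    start cs with missed-value k<m (λ j → class (cs j))
    ... | ℓ , missed = member ℓ , λ j eq → missed j (trans eq (class-member ℓ))

no-cops-lose : (𝒢 : PeriodicGraph) → Fin (n 𝒢) → ¬ CopsWin 𝒢 0
no-cops-lose 𝒢 v = fewer-cops-than-classes⇒¬CopsWin 𝒢 (const zero) (const v)
  (λ _ _ _ _ → refl) (λ { zero → refl ; (suc ()) }) 0 (n<1+n 0)

copNumber-of-dominated-classes :
  (G : Graph) {m : ℕ} (class : Fin (vn G) → Fin m) (centre : Fin m → Fin (vn G)) →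
  (∀ u v → Adj G u v → class u ≡ class v) → (∀ ℓ → class (centre ℓ) ≡ ℓ) →
  (∀ v → Adj G (centre (class v)) v) → IsCopNumber (static G) m
copNumber-of-dominated-classes G class centre respects class-centre dominates =
  dominating⇒CopsWin (static G) centre (λ r → class r , dominates r) ,
  fewer-cops-than-classes⇒¬CopsWin (static G) class centre (λ _ → respects) class-centre

dominated⇒Connected : (G : Graph) (c : Fin (vn G)) → (∀ v → Adj G c v) → Connected G
dominated⇒Connected G c dom = (c , tt) , λ u v → step (step here (Adj-sym G c u (dom u))) (dom v)

link₀ : ℕ → ℕ → ℕ → Bool
link₀ 0 0 3 = true
link₀ 0 1 2 = true
link₀ 1 0 1 = true
link₀ 1 2 3 = true
link₀ 1 1 4 = true
link₀ 2 0 2 = true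
link₀ 2 1 3 = true
link₀ 2 1 4 = true
link₀ _ _ _ = false

Link₀ : Fin 3 → Rel (Fin 5) 0ℓ
Link₀ i u v = T (link₀ (toℕ i) (toℕ u) (toℕ v))

Edge₀ : Fin 3 → Rel (Fin 5) 0ℓ
Edge₀ i = ReflClosure (SymClosure (Link₀ i))

edge₀? : ∀ i → Decidable (Edge₀ i)
edge₀? i = Refl.dec _≟_ (symClosure? λ u v → T? (link₀ (toℕ i) (toℕ u) (toℕ v)))

𝒢₀ : PeriodicGraph
𝒢₀ = record
  { n = 5 ; q = 2 ; E = Edge₀
  ; E-refl = λ _ _ → Refl.refl
  ; E-sym = λ i _ _ → Refl.sym (symmetric (Link₀ i)) }

pendant : Fin 5
pendant = # 4

hub : Fin 5
hub = # 1

hub-dominates : ∀ v → Adj (footprint 𝒢₀) hub v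
hub-dominates = from-yes (all? λ v → any? λ i → edge₀? i hub v)

footprint-copNumber : IsCopNumber (static (footprint 𝒢₀)) 1
footprint-copNumber =
  copNumber-of-dominated-classes (footprint 𝒢₀) (const zero) (const hub)
    (λ _ _ _ → refl) (λ { zero → refl ; (suc ()) }) hub-dominates

classes : Fin 3 → ℕ
classes zero = 3
classes (suc _) = 2

class : ∀ i → Fin 5 → Fin (classes i)
class zero = lookup (# 0 ∷ # 1 ∷ # 1 ∷ # 0 ∷ # 2 ∷ [])
class (suc zero) = lookup (# 0 ∷ # 0 ∷ # 1 ∷ # 1 ∷ # 0 ∷ [])
class (suc (suc zero)) = lookup (# 0 ∷ # 1 ∷ # 0 ∷ # 1 ∷ # 1 ∷ [])

centre : ∀ i → Fin (classes i) → Fin 5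
centre zero = lookup (# 0 ∷ # 1 ∷ # 4 ∷ [])
centre (suc zero) = lookup (# 1 ∷ # 2 ∷ [])
centre (suc (suc zero)) = lookup (# 0 ∷ # 1 ∷ [])

class-respects : ∀ i u v → Edge₀ i u v → class i u ≡ class i v
class-respects = from-yes (all? λ i → all? λ u → all? λ v → edge₀? i u v →-dec (class i u ≟ class i v))

class-centre : ∀ i ℓ → class i (centre i ℓ) ≡ ℓ
class-centre = from-yes (all? λ i → all? λ ℓ → class i (centre i ℓ) ≟ ℓ)

centre-dominates : ∀ i v → Edge₀ i (centre i (class i v)) v
centre-dominates = from-yes (all? λ i → all? λ v → edge₀? i (centre i (class i v)) v)

layer-copNumber : ∀ i → IsCopNumber (static (layer 𝒢₀ i)) (classes i)
layer-copNumber i = copNumber-of-dominated-classes (layer 𝒢₀ i) (class i) (centre i)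
  (class-respects i) (class-centre i) (centre-dominates i)

two-cops-win : CopsWin 𝒢₀ 2
two-cops-win = cops , strategy
  where
  cops : Fin 2 → Fin 5
  cops = lookup (# 0 ∷ hub ∷ [])
  reach-or-pendant : ∀ r → (∃ λ j → Edge₀ zero (cops j) r) ⊎ r ≡ pendant
  reach-or-pendant = from-yes (all? λ r → any? (λ j → edge₀? zero (cops j) r) ⊎-dec (r ≟ pendant))
  pendant-stuck : ∀ r → Edge₀ zero pendant r → r ≡ pendant
  pendant-stuck = from-yes (all? λ r → edge₀? zero pendant r →-dec (r ≟ pendant))
  strategy : ∀ r → Win 𝒢₀ 2 0 cops r
  strategy r with reach-or-pendant r
  ... | inj₁ (j , e) = capture 𝒢₀ j e
  ... | inj₂ refl    = wait 𝒢₀ λ r′ e → subst (Win 𝒢₀ 2 1 cops) (sym (pendant-stuck r′ e))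
                         (capture 𝒢₀ (suc zero) Refl.[ fwd tt ])

next-phase : Fin 3 → Fin 3
next-phase i = suc (toℕ i) mod 3

Safe₀ : Fin 3 → Fin 5 → Fin 5 → Set
Safe₀ i c r = r ≢ pendant × ¬ Edge₀ i c r

safe₀? : ∀ i c r → Dec (Safe₀ i c r)
safe₀? i c r = ¬? (r ≟ pendant) ×-dec ¬? (edge₀? i c r)

safe₀-start : ∀ c → ∃ λ r → Safe₀ zero c r
safe₀-start = from-yes (all? λ c → any? λ r → safe₀? zero c r)

-- Opaque: this computed proof is huge, and unfolding it in one-cop-loses exhausts memory.
opaque
  safe₀-reply : ∀ i c r → Safe₀ i c r → ∀ c′ → Edge₀ i c c′ →
                ∃ λ r′ → Edge₀ i r r′ × Safe₀ (next-phase i) c′ r′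
  safe₀-reply = from-yes (all? λ i → all? λ c → all? λ r → safe₀? i c r →-dec
    (all? λ c′ → edge₀? i c c′ →-dec any? λ r′ → edge₀? i r r′ ×-dec safe₀? (next-phase i) c′ r′))

one-cop-loses : ¬ CopsWin 𝒢₀ 1
one-cop-loses = escape⇒¬CopsWin 𝒢₀ {1} {SafeAt} escape (λ cs → safe₀-start (cs zero))
  where
  SafeAt : ℕ → (Fin 1 → Fin 5) → Fin 5 → Set
  SafeAt t cs r = Safe₀ (t mod 3) (cs zero) r
  escape : Escape 𝒢₀ SafeAt
  escape t cs r safe cs′ moves with safe₀-reply _ _ _ safe (cs′ zero) (moves zero)
  ... | r′ , e , safe′ = uncaught , r′ , e , subst (λ i → Safe₀ i (cs′ zero) r′) (sym (suc-mod t 3)) safe′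
    where
    uncaught : ∀ j → cs′ j ≢ r
    uncaught zero eq = proj₂ safe (subst (Edge₀ (t mod 3) (cs zero)) eq (moves zero))

periodic-copNumber : IsCopNumber 𝒢₀ 2
periodic-copNumber = two-cops-win , fewer-cops
  where
  fewer-cops : ∀ k → k < 2 → ¬ CopsWin 𝒢₀ k
  fewer-cops 0 _ = no-cops-lose 𝒢₀ hub
  fewer-cops 1 _ = one-cop-loses
  fewer-cops (suc (suc _)) (s≤s (s≤s ()))

lemma4 : Σ PeriodicGraph λ 𝒢 →
           Connected (footprint 𝒢) ×
           (Σ ℕ λ cG → Σ ℕ λ c𝒢 → Σ (Fin (period 𝒢) → ℕ) λ cs →
             IsCopNumber (static (footprint 𝒢)) cG ×
             IsCopNumber 𝒢 c𝒢 ×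
             (∀ i → IsCopNumber (static (layer 𝒢 i)) (cs i)) ×
             cG < c𝒢 × c𝒢 < maxFin cs)
lemma4 =
  𝒢₀ , dominated⇒Connected (footprint 𝒢₀) hub hub-dominates ,
  1 , 2 , classes ,
  footprint-copNumber , periodic-copNumber , layer-copNumber ,
  n<1+n 1 , n<1+n 2
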